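{- Let $T=[q_0,q_{ -1},q_\infty]$ be a Farey triple in $\mathbb{T}_3^{ -1}$ with assigned extended exchange matrix $M$. For a $3\times3$ matrix $N=(n_{ij})$ define $N^{\phi}=(n_{\tau(i)\tau(j)})$ and $N^{\psi}=(n_{\tau^{ -1}(i)\tau^{ -1}(j)})$, where $\tau$ is the permutation of $\{1,2,3\}$ with $\tau(1)=3,\tau(2)=1,\tau(3)=2$; for a $6\times3$ matrix apply this to its top and bottom $3\times3$ blocks separately. Then the extended exchange matrix assigned to $\phi(T)$ is $M^{\phi}$, and the extended exchange matrix assigned to $\psi(T)$ is $M^{\psi}$.
   Context: Farey triples: for $q\in\mathbb{Q}_\infty=\mathbb{Q}\cup\{\infty\}$ ($\infty$ largest), $d(q),r(q)$ are the integers with $q=d(q)/r(q)$, $\gcd=1$, $r(q)\ge0$ ($0=0/1$, $\infty=1/0$). A Farey triple is an unordered triple of elements of $\mathbb{Q}_\infty$ with $|d(q)r(q')-d(q')r(q)|=1$ for each pair; with components $q_f<q_s<q_t$ its mutations are $\mu_f:[q_s,\frac{d(q_s)+d(q_t)}{r(q_s)+r(q_t)},q_t]$, $\mu_s:[q_f,\frac{d(q_f)-d(q_t)}{r(q_f)-r(q_t)},q_t]$, $\mu_t:[q_f,\frac{d(q_f)+d(q_s)}{r(q_f)+r(q_s)},q_s]$. Each Farey triple has exactly one component of each type $\frac{\text{even}}{\text{odd}},\frac{\text{odd}}{\text{odd}},\frac{\text{odd}}{\text{even}}$, written in order $[q_0,q_{ -1},q_\infty]$; $\mu_0,\mu_{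 -1},\mu_\infty$ mutate the component of the respective type. The exchange graph is a 3-regular tree $\mathbb{T}_3$, edges labeled $0,-1,\infty$ by the mutation type. $\mathbb{T}_3^i$ ($i\in\{0,-1,\infty\}$) is the connected component of $\mathbb{T}_3$ minus $[\tfrac01,\tfrac{ -1}{1},\tfrac10]$ containing $\mu_i[\tfrac01,\tfrac{ -1}{1},\tfrac10]$. $\phi:\mathbb{T}_3^{ -1}\to\mathbb{T}_3^\infty$ is the graph isomorphism sending $[\tfrac01,\tfrac11,\tfrac10]$ to $[\tfrac01,\tfrac{ -1}{1},\tfrac{ -1}{2}]$ and edges labeled $-1,0,\infty$ to edges labeled $\infty,-1,0$; $\psi:\mathbb{T}_3^{ -1}\to\mathbb{T}_3^0$ is the graph isomorphism sending $[\tfrac01,\tfrac11,\tfrac10]$ to $[\tfrac{ -2}{1},\tfrac{ -1}{1},\tfrac10]$ and edges labeled $-1,0,\infty$ to edges labeled $0,\infty,-1$. Matrices: rows/columns $1,2,3$ labeled $0,-1,\infty$. $B^+=\begin{pmatrix}0&-2&2\\2&0&-2\\-2&2&0\end{pmatrix}$. Matrix mutation $\mu_k$: $b'_{ij}=-b_{ij}$ if $i=k$ or $j=k$, else $b_{ij}+\mathrm{sgn}(b_{ik})[b_{ik}b_{kj}]_+$; $\mu_0,\mu_{ -1},\mu_\infty=\mu_1,\mu_2,\mu_3$. $\tilde B_0$ is the $6\times3$ matrix with top block $B^+$ and bottom block $I_3$; the matrix assigned to $\mu_{a_n}\cdots\mu_{a_1}[\tfrac01,\tfrac{ -1}{1},\tfrac10]$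 is $\mu_{a_n}\cdots\mu_{a_1}(\tilde B_0)$. -}

module Defs where

open import Data.Nat using (ℕ)
open import Data.Integer using (ℤ; +_; +[1+_]; -[1+_]; _+_; _*_; -_)
open import Data.Fin using (Fin; zero; suc; _≟_; _↑ˡ_)
open import Data.List using (List; []; _∷_; map)
open import Data.Product using (_×_)
open import Data.Unit using (⊤)
open import Data.Empty using (⊥)
open import Relation.Nullary using (yes; no)
open import Relation.Binary.PropositionalEquality using (_≡_)

-- Mutation labels 0, -1, ∞ (indices 1,2,3 of the matrices, i.e. Fin 3
-- entries 0,1,2).

data Label : Set where
  l0 lm1 linf : Label

idx : Label → Fin 3
idx l0   = zero
idx lm1  = suc zero
idx linf = suc (suc zero)

-- Vertices of the exchange graph 𝕋₃ = reduced words of mutations applied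
-- to the initial Farey triple [0/1, -1/1, 1/0].  A word (a₁ ∷ a₂ ∷ … ∷ aₙ)
-- denotes μ_{aₙ} ⋯ μ_{a₁} [0/1,-1/1,1/0] (a₁ is applied first).
-- Reduced = no two consecutive equal labels (μ_k is an involution).

_≠L_ : Label → Label → Set
l0   ≠L l0   = ⊥
lm1  ≠L lm1  = ⊥
linf ≠L linf = ⊥
_    ≠L _    = ⊤

Reduced : List Label → Set
Reduced []            = ⊤
Reduced (a ∷ [])      = ⊤
Reduced (a ∷ b ∷ w)   = (a ≠L b) × Reduced (b ∷ w)

-- A vertex of 𝕋₃^{-1} is exactly a reduced word whose first letter is -1;
-- we represent it by the tail w of the word (lm1 ∷ w).

-- φ : 𝕋₃^{-1} → 𝕋₃^∞ : root μ_{-1}T₀ ↦ μ_∞T₀, labels -1,0,∞ ↦ ∞,-1,0.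
σφ : Label → Label
σφ lm1  = linf
σφ l0   = lm1
σφ linf = l0

-- ψ : 𝕋₃^{-1} → 𝕋₃^0 : root μ_{-1}T₀ ↦ μ_0T₀, labels -1,0,∞ ↦ 0,∞,-1.
σψ : Label → Label
σψ lm1  = l0
σψ l0   = linf
σψ linf = lm1

-- image of the vertex (lm1 ∷ w) as a word from T₀
φV : List Label → List Label
φV w = linf ∷ map σφ w

ψV : List Label → List Label
ψV w = l0 ∷ map σψ w

Mat : Set
Mat = Fin 6 → Fin 3 → ℤ

sgn : ℤ → ℤ
sgn (+ 0)      = + 0
sgn +[1+ _ ]   = + 1
sgn -[1+ _ ]   = -[1+ 0 ]

pos : ℤ → ℤ
pos +[1+ n ]   = +[1+ n ]
pos _          = + 0

mutMat : Fin 3 → Mat → Mat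
mutMat k B i j with i ≟ (k ↑ˡ 3) | j ≟ k
... | yes _ | _     = - B i j
... | no _  | yes _ = - B i j
... | no _  | no _  = B i j + sgn (B i k) * pos (B i k * B ((k ↑ˡ 3)) j)

mutSeq : List Label → Mat → Mat
mutSeq []      B = B
mutSeq (a ∷ w) B = mutSeq w (mutMat (idx a) B)

B̃₀ : Mat
B̃₀ zero                                  zero                = + 0
B̃₀ zero                                  (suc zero)          = -[1+ 1 ]
B̃₀ zero                                  (suc (suc zero))    = + 2
B̃₀ (suc zero)                            zero                = + 2
B̃₀ (suc zero)                            (suc zero)          = + 0
B̃₀ (suc zero)                            (suc (suc zero))    = -[1+ 1 ]
B̃₀ (suc (suc zero))                      zero                = -[1+ 1 ]
B̃₀ (suc (suc zero))                      (suc zero)          = + 2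
B̃₀ (suc (suc zero))                      (suc (suc zero))    = + 0
B̃₀ (suc (suc (suc zero)))                zero                = + 1
B̃₀ (suc (suc (suc (suc zero))))          (suc zero)          = + 1
B̃₀ (suc (suc (suc (suc (suc zero)))))    (suc (suc zero))    = + 1
B̃₀ _                                     _                   = + 0

assigned : List Label → Mat
assigned w = mutSeq w B̃₀

-- The permutation τ (1↦3, 2↦1, 3↦2), 0-indexed, and its inverse.

τ : Fin 3 → Fin 3
τ zero             = suc (suc zero)
τ (suc zero)       = zero
τ (suc (suc zero)) = suc zero

τ⁻¹ : Fin 3 → Fin 3
τ⁻¹ zero             = suc zero
τ⁻¹ (suc zero)       = suc (suc zero)
τ⁻¹ (suc (suc zero)) = zero

blockRow : (Fin 3 → Fin 3) → Fin 6 → Fin 6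
blockRow p zero                = (p zero ↑ˡ 3)
blockRow p (suc zero)          = (p (suc zero) ↑ˡ 3)
blockRow p (suc (suc zero))    = (p (suc (suc zero)) ↑ˡ 3)
blockRow p (suc (suc (suc i))) = suc (suc (suc (p i)))

_^φ : Mat → Mat
(M ^φ) i j = M (blockRow τ i) (τ j)

_^ψ : Mat → Mat
(M ^ψ) i j = M (blockRow τ⁻¹ i) (τ⁻¹ j)

module Submission where

-- Relabelling the indices of an extended exchange matrix by a
-- permutation p of {0,-1,∞} (rows of both blocks and columns alike) commutes
-- with matrix mutation: mutating the relabelled matrix in direction k is the
-- relabelling of the mutation in direction p k.  Hence mutating along a word
-- whose letters are renamed by σ, with p ∘ idx ∘ σ = idx, transports the
-- relabelling along the whole word.  The initial matrix B̃₀ is invariant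
-- under the cyclic relabelling τ (B⁺ is circulant), hence also under τ⁻¹.
-- Since φ and ψ rename the labels -1,0,∞ compatibly with τ and τ⁻¹, and send
-- the root μ₋₁T₀ to the root μ_∞T₀ resp. μ₀T₀, the word of φ(T) (resp. ψ(T))
-- is the σ-renaming of the word of T, and the theorem follows.

open import Defs
open import Data.List using (List; []; _∷_; map)
open import Data.Fin using (Fin; zero; suc; _≟_; _↑ˡ_)
open import Data.Product using (_×_; _,_)
open import Data.Integer using (_+_; _*_; -_)
open import Relation.Nullary using (yes; no; contradiction)
open import Relation.Binary.PropositionalEquality
  using (_≡_; refl; cong; cong₂; trans; sym; module ≡-Reasoning)

_≈_ : Mat → Mat → Set
A ≈ B = (i : Fin 6) (j : Fin 3) → A i j ≡ B i j

_LeftInverseOf_ : (Fin 3 → Fin 3) → (Fin 3 → Fin 3) → Set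
q LeftInverseOf p = (x : Fin 3) → q (p x) ≡ x

τ⁻¹-τ : τ⁻¹ LeftInverseOf τ
τ⁻¹-τ zero             = refl
τ⁻¹-τ (suc zero)       = refl
τ⁻¹-τ (suc (suc zero)) = refl

τ-τ⁻¹ : τ LeftInverseOf τ⁻¹
τ-τ⁻¹ zero             = refl
τ-τ⁻¹ (suc zero)       = refl
τ-τ⁻¹ (suc (suc zero)) = refl

blockRow-top : (p : Fin 3 → Fin 3) (k : Fin 3) → blockRow p (k ↑ˡ 3) ≡ p k ↑ˡ 3
blockRow-top p zero             = refl
blockRow-top p (suc zero)       = refl
blockRow-top p (suc (suc zero)) = refl

blockRow-inverse : (p q : Fin 3 → Fin 3) → q LeftInverseOf p →
                   (i : Fin 6) → blockRow q (blockRow p i) ≡ i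
blockRow-inverse p q inv zero =
  trans (blockRow-top q (p zero)) (cong (_↑ˡ 3) (inv zero))
blockRow-inverse p q inv (suc zero) =
  trans (blockRow-top q (p (suc zero))) (cong (_↑ˡ 3) (inv (suc zero)))
blockRow-inverse p q inv (suc (suc zero)) =
  trans (blockRow-top q (p (suc (suc zero)))) (cong (_↑ˡ 3) (inv (suc (suc zero))))
blockRow-inverse p q inv (suc (suc (suc i))) = cong (λ x → suc (suc (suc x))) (inv i)

-- Simultaneous relabelling of rows (blockwise) and columns by p.
-- Note  M ^φ = relabel τ M  and  M ^ψ = relabel τ⁻¹ M  definitionally.
relabel : (Fin 3 → Fin 3) → Mat → Mat
relabel p M i j = M (blockRow p i) (p j)

mutMat-cong : (k : Fin 3) {A B : Mat} → A ≈ B → mutMat k A ≈ mutMat k B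
mutMat-cong k e i j with i ≟ (k ↑ˡ 3) | j ≟ k
... | yes _ | _     = cong -_ (e i j)
... | no _  | yes _ = cong -_ (e i j)
... | no _  | no _  =
  cong₂ _+_ (e i j)
    (cong₂ _*_ (cong sgn (e i k)) (cong pos (cong₂ _*_ (e i k) (e (k ↑ˡ 3) j))))

mutMat-relabel : (p q : Fin 3 → Fin 3) → q LeftInverseOf p →
                 (k : Fin 3) (M : Mat) →
                 mutMat k (relabel p M) ≈ relabel p (mutMat (p k) M)
mutMat-relabel p q inv k M i j
  with i ≟ (k ↑ˡ 3) | j ≟ k | blockRow p i ≟ (p k ↑ˡ 3) | p j ≟ p k
... | yes _   | _      | yes _   | _      = refl
... | yes i≡k | _      | no i≢k  | _      =
  contradiction (trans (cong (blockRow p) i≡k) (blockRow-top p k)) i≢k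
... | no i≢k  | _      | yes i≡k | _      = contradiction rowInjective i≢k
  where
  rowInjective : i ≡ k ↑ˡ 3
  rowInjective = begin
    i                               ≡⟨ sym (blockRow-inverse p q inv i) ⟩
    blockRow q (blockRow p i)       ≡⟨ cong (blockRow q) i≡k ⟩
    blockRow q (p k ↑ˡ 3)           ≡⟨ blockRow-top q (p k) ⟩
    q (p k) ↑ˡ 3                    ≡⟨ cong (_↑ˡ 3) (inv k) ⟩
    k ↑ˡ 3                          ∎
    where open ≡-Reasoning
... | no _    | yes _  | no _    | yes _  = refl
... | no _    | yes j≡k | no _   | no j≢k = contradiction (cong p j≡k) j≢k
... | no _    | no j≢k | no _    | yes j≡k =
  contradiction (trans (sym (inv j)) (trans (cong q j≡k) (inv k))) j≢k
... | no _    | no _   | no _    | no _   =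
  cong (λ r → M (blockRow p i) (p j)
              + sgn (M (blockRow p i) (p k)) * pos (M (blockRow p i) (p k) * M r (p j)))
       (blockRow-top p k)

mutSeq-relabel : (p q : Fin 3 → Fin 3) → q LeftInverseOf p →
                 (σ : Label → Label) → ((a : Label) → p (idx (σ a)) ≡ idx a) →
                 (w : List Label) {A N : Mat} → A ≈ relabel p N →
                 mutSeq (map σ w) A ≈ relabel p (mutSeq w N)
mutSeq-relabel p q inv σ compat []      e = e
mutSeq-relabel p q inv σ compat (a ∷ w) {A} {N} e =
  mutSeq-relabel p q inv σ compat w step
  where
  step : mutMat (idx (σ a)) A ≈ relabel p (mutMat (idx a) N)
  step i j = begin
    mutMat (idx (σ a)) A i j                         ≡⟨ mutMat-cong (idx (σ a)) e i j ⟩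
    mutMat (idx (σ a)) (relabel p N) i j             ≡⟨ mutMat-relabel p q inv (idx (σ a)) N i j ⟩
    relabel p (mutMat (p (idx (σ a))) N) i j         ≡⟨ cong (λ k → relabel p (mutMat k N) i j) (compat a) ⟩
    relabel p (mutMat (idx a) N) i j                 ∎
    where open ≡-Reasoning

relabel-invariant-inverse : (p q : Fin 3 → Fin 3) → p LeftInverseOf q →
                            (M : Mat) → M ≈ relabel p M → M ≈ relabel q M
relabel-invariant-inverse p q inv M e i j = begin
  M i j                                            ≡⟨ cong₂ M (sym (blockRow-inverse q p inv i)) (sym (inv j)) ⟩
  M (blockRow p (blockRow q i)) (p (q j))          ≡⟨ sym (e (blockRow q i) (q j)) ⟩
  M (blockRow q i) (q j)                           ∎
  where open ≡-Reasoning

-- B⁺ is circulant and the frozen part is the identity, so B̃₀ is τ-invariant.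
B̃₀-τ-invariant : B̃₀ ≈ relabel τ B̃₀
B̃₀-τ-invariant zero                                zero             = refl
B̃₀-τ-invariant zero                                (suc zero)       = refl
B̃₀-τ-invariant zero                                (suc (suc zero)) = refl
B̃₀-τ-invariant (suc zero)                          zero             = refl
B̃₀-τ-invariant (suc zero)                          (suc zero)       = refl
B̃₀-τ-invariant (suc zero)                          (suc (suc zero)) = refl
B̃₀-τ-invariant (suc (suc zero))                    zero             = refl
B̃₀-τ-invariant (suc (suc zero))                    (suc zero)       = refl
B̃₀-τ-invariant (suc (suc zero))                    (suc (suc zero)) = refl
B̃₀-τ-invariant (suc (suc (suc zero)))              zero             = refl
B̃₀-τ-invariant (suc (suc (suc zero)))              (suc zero)       = refl
B̃₀-τ-invariant (suc (suc (suc zero)))              (suc (suc zero)) = refl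
B̃₀-τ-invariant (suc (suc (suc (suc zero))))        zero             = refl
B̃₀-τ-invariant (suc (suc (suc (suc zero))))        (suc zero)       = refl
B̃₀-τ-invariant (suc (suc (suc (suc zero))))        (suc (suc zero)) = refl
B̃₀-τ-invariant (suc (suc (suc (suc (suc zero)))))  zero             = refl
B̃₀-τ-invariant (suc (suc (suc (suc (suc zero)))))  (suc zero)       = refl
B̃₀-τ-invariant (suc (suc (suc (suc (suc zero)))))  (suc (suc zero)) = refl

σφ-compat : (a : Label) → τ (idx (σφ a)) ≡ idx a
σφ-compat l0   = refl
σφ-compat lm1  = refl
σφ-compat linf = refl

σψ-compat : (a : Label) → τ⁻¹ (idx (σψ a)) ≡ idx a
σψ-compat l0   = refl
σψ-compat lm1  = refl
σψ-compat linf = refl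

-- Since σφ lm1 = linf and σψ lm1 = l0, the words φV w and ψV w are
-- definitionally map σφ (lm1 ∷ w) and map σψ (lm1 ∷ w).
mainTheorem6 : (w : List Label) → Reduced (lm1 ∷ w) →
    ((i : Fin 6) (j : Fin 3) → assigned (φV w) i j ≡ (assigned (lm1 ∷ w) ^φ) i j)
    × ((i : Fin 6) (j : Fin 3) → assigned (ψV w) i j ≡ (assigned (lm1 ∷ w) ^ψ) i j)
mainTheorem6 w _ =
    mutSeq-relabel τ τ⁻¹ τ⁻¹-τ σφ σφ-compat (lm1 ∷ w) B̃₀-τ-invariant
  , mutSeq-relabel τ⁻¹ τ τ-τ⁻¹ σψ σψ-compat (lm1 ∷ w)
      (relabel-invariant-inverse τ τ⁻¹ τ-τ⁻¹ B̃₀ B̃₀-τ-invariant)
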